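{- The type $B$ permutahedra of dimension 3 and of dimension 4 have facet-Hamiltonian cycles.
   Context: The $n$-dimensional type $B$ permutahedron is the convex hull in $\mathbb{R}^n$ of all points $(\pm\pi(1),\ldots,\pm\pi(n))$ with $\pi$ a permutation of $[n]$ and arbitrary signs (signed permutations). The skeleton of a polytope is its vertex-edge graph; a cycle $C$ in the skeleton is facet-Hamiltonian if for every facet $f$ of the polytope, $f\cap C$ is nonempty and connected. -}

module Defs where

open import Data.Nat using (ℕ; zero; suc; _+_; _<_; NonZero)
  renaming (_≤_ to _≤ℕ_)
open import Data.Nat.DivMod using (_mod_)
open import Data.Integer using (ℤ; _≤_; ∣_∣) renaming (_+_ to _+ℤ_; _*_ to _*ℤ_)
open import Data.Fin using (Fin; toℕ)
open import Data.Vec using (Vec; lookup; []; _∷_)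
open import Data.Product using (Σ; _×_; ∃; ∃-syntax)
open import Data.Sum using (_⊎_)
open import Relation.Binary.PropositionalEquality using (_≡_; _≢_)
open import Relation.Nullary using (¬_)
open import Function.Bundles using (_⇔_)

-- Points of ℝⁿ with integer coordinates (all relevant points are integral).
Point : ℕ → Set
Point n = Vec ℤ n

dot : ∀ {n} → Vec ℤ n → Vec ℤ n → ℤ
dot [] [] = Data.Integer.0ℤ
dot (c ∷ cs) (v ∷ vs) = (c *ℤ v) +ℤ dot cs vs

-- v = (±π(1),…,±π(n)) for a permutation π of [n] and arbitrary signs:
-- the absolute values of the coordinates are in {1..n} and pairwise distinct.
IsSignedPerm : (n : ℕ) → Point n → Set
IsSignedPerm n v =
  (∀ i → (1 ≤ℕ ∣ lookup v i ∣) × (∣ lookup v i ∣ ≤ℕ n)) ×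
  (∀ i j → ∣ lookup v i ∣ ≡ ∣ lookup v j ∣ → i ≡ j)

-- The type B permutahedron P = conv(signed permutations).  A face of P is
-- given by a linear functional c (integral normals suffice, P being a
-- lattice polytope); we record it by the generating points it contains:
-- w lies in the face of c iff w is a signed permutation maximising c·_ .
InFace : (n : ℕ) → Point n → Point n → Set
InFace n c w = IsSignedPerm n w × (∀ u → IsSignedPerm n u → dot c u ≤ dot c w)

-- Facets: maximal proper faces (P is full-dimensional).
IsFacet : (n : ℕ) → Point n → Set
IsFacet n c =
  (∃[ w ] (IsSignedPerm n w × ¬ InFace n c w)) ×
  (∀ c′ → (∀ w → InFace n c w → InFace n c′ w) →
     (∀ w → IsSignedPerm n w → InFace n c′ w) ⊎ (∀ w → InFace n c′ w → InFace n c w))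

-- Edges of the skeleton: faces whose points are exactly two distinct
-- points u, v (all generating points are vertices of P).
Adjacent : (n : ℕ) → Point n → Point n → Set
Adjacent n u v = u ≢ v × ∃[ c ] (∀ w → InFace n c w ⇔ ((w ≡ u) ⊎ (w ≡ v)))

IsCycle : (n m : ℕ) → (Fin (3 + m) → Point n) → Set
IsCycle n m C =
  (∀ i j → C i ≡ C j → i ≡ j) ×
  (∀ i → Adjacent n (C i) (C ((suc (toℕ i)) mod (3 + m))))

-- f ∩ C is nonempty and connected: the positions of C lying in the facet f
-- form a single nonempty cyclic arc  s, s+1, …, s+k-1 (mod length).
FacetHamiltonian : (n m : ℕ) → (Fin (3 + m) → Point n) → Set
FacetHamiltonian n m C =
  ∀ c → IsFacet n c →
    Σ (Fin (3 + m)) λ s → Σ ℕ λ k → ((1 ≤ℕ k) × (k ≤ℕ 3 + m) ×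
      (∀ i → InFace n c (C i) ⇔ (Σ ℕ λ j → ((j < k) × (i ≡ (toℕ s + j) mod (3 + m))))))

HasFacetHamiltonianCycle : ℕ → Set
HasFacetHamiltonianCycle n =
  ∃[ m ] ∃[ C ] (IsCycle n m C × FacetHamiltonian n m C)

module Submission where

-- Every vertex w maximising a functional c agrees with c in sign and orders its absolute
-- values like those of c: otherwise flipping the sign of one coordinate, or exchanging the
-- absolute values of two, would increase c·w. Hence the face of a facet normal c lies in the
-- face of the sign vector of the coordinates where ∣cᵢ∣ is maximal, and by maximality of
-- facets the two faces coincide. It therefore suffices to check, over an enumeration of the
-- vertices, that the cycle meets the face of each of the 3ⁿ − 1 nonzero sign vectors in one
-- arc, and that its consecutive vertices u, v span edges, witnessed by the functional u + v.

open import Defs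
import Algebra.Properties.CommutativeSemigroup as CommutativeSemigroupProperties
open import Data.Bool.ListAction using (all; any)
open import Data.Empty using (⊥-elim)
open import Data.Fin.Base as Fin using (Fin; zero; suc; toℕ)
import Data.Fin.Properties as Fin
open import Data.Fin.Permutation.Components using (transpose; transpose-inverse)
open import Data.Integer.Base as ℤ
  using (ℤ; +_; +0; +[1+_]; -[1+_]; -_; ∣_∣; sign; _◃_; 0ℤ; 1ℤ; -1ℤ; +≤+; +<+; _≤_; _<_; _+_; _*_)
import Data.Integer.Properties as ℤ
open import Data.List.Base as List using (List; []; _∷_; [_]; cartesianProductWith; filter)
open import Data.List.Membership.Propositional using (_∈_; find)
open import Data.List.Membership.Propositional.Properties
  using (∈-filter⁺; ∈-filter⁻; ∈-cartesianProductWith⁺)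
open import Data.List.Relation.Unary.All as All using (All)
open import Data.List.Relation.Unary.All.Properties using (all⁺; all⁻)
open import Data.List.Relation.Unary.Any as Any using (Any; here; there)
open import Data.List.Relation.Unary.Any.Properties using (any⁺; any⁻)
open import Data.Maybe.Base using (fromMaybe)
open import Data.Nat.Base as ℕ using (ℕ; zero; suc; z≤n; s≤s; _⊔_)
import Data.Nat.Properties as ℕ
open import Data.Nat.DivMod using (_mod_)
open import Data.Nat.Solver using (module +-*-Solver)
open import Data.Product using (_×_; _,_; proj₁; proj₂; ∃-syntax)
import Data.Sign.Base as Sign
open import Data.Sign.Properties using (s*s≡+)
open import Data.Sum using (_⊎_; inj₁; inj₂)
open import Data.Vec.Base as Vec using (Vec; []; _∷_; lookup; _[_]≔_; replicate; zipWith)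
open import Data.Vec.Properties
  using (lookup∘update; lookup∘update′; lookup-map; lookup-replicate; ≡-dec)
open import Function.Base using (_∘_; id)
open import Function.Bundles using (_⇔_; mk⇔; Equivalence)
open import Function.Definitions using (Injective)
open import Relation.Binary.PropositionalEquality
  using (_≡_; _≢_; refl; sym; trans; cong; cong₂; subst; subst₂; module ≡-Reasoning)
open import Relation.Nullary.Decidable
  using (Dec; isYes; yes; no; map′; T?; ¬?; _×-dec_; _⊎-dec_; _→-dec_; True; toWitness; fromWitness;
         dec-true; dec-false)
open import Relation.Nullary.Negation using (¬_; contradiction)
open import Relation.Unary using (Decidable)

private
  module ℤ+ = CommutativeSemigroupProperties ℤ.+-commutativeSemigroup

_⇔?_ : ∀ {A B : Set} → Dec A → Dec B → Dec (A ⇔ B)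
a? ⇔? b? = map′ (λ (to , from) → mk⇔ to from) (λ A⇔B → Equivalence.to A⇔B , Equivalence.from A⇔B)
                ((a? →-dec b?) ×-dec (b? →-dec a?))

-- Deciding All and Any through a Boolean fold keeps no intermediate proofs alive while a
-- large certificate is evaluated.
allᵇ? : ∀ {A : Set} {P : A → Set} → Decidable P → Decidable (All P)
allᵇ? P? xs = map′ (All.map (λ {x} → toWitness {a? = P? x}) ∘ all⁺ _ xs)
                   (all⁻ _ ∘ All.map (λ {x} → fromWitness {a? = P? x})) (T? (all (isYes ∘ P?) xs))

anyᵇ? : ∀ {A : Set} {P : A → Set} → Decidable P → Decidable (Any P)
anyᵇ? P? xs = map′ (Any.map (λ {x} → toWitness {a? = P? x}) ∘ any⁻ _ xs)
                   (any⁺ _ ∘ Any.map (λ {x} → fromWitness {a? = P? x})) (T? (any (isYes ∘ P?) xs))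

_≟ᵥ_ : ∀ {n} → (u v : Point n) → Dec (u ≡ v)
_≟ᵥ_ = ≡-dec ℤ._≟_

vectorsOver : ∀ {A : Set} → List A → (n : ℕ) → List (Vec A n)
vectorsOver xs zero    = [ [] ]
vectorsOver xs (suc n) = cartesianProductWith _∷_ xs (vectorsOver xs n)

∈-vectorsOver : ∀ {A : Set} {xs : List A} {n} {v : Vec A n} →
                (∀ i → lookup v i ∈ xs) → v ∈ vectorsOver xs n
∈-vectorsOver {v = []}    _     = here refl
∈-vectorsOver {v = x ∷ v} v⊆xs = ∈-cartesianProductWith⁺ _∷_ (v⊆xs zero) (∈-vectorsOver (v⊆xs ∘ suc))

signedValues : ℕ → List ℤ
signedValues zero    = []
signedValues (suc k) = +[1+ k ] ∷ -[1+ k ] ∷ signedValues k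

∈-signedValues : ∀ {k x} → 1 ℕ.≤ ∣ x ∣ × ∣ x ∣ ℕ.≤ k → x ∈ signedValues k
∈-signedValues {suc k} {+[1+ a ]} (_ , s≤s a≤k) with ℕ.m≤n⇒m<n∨m≡n a≤k
... | inj₁ a<k  = there (there (∈-signedValues (s≤s z≤n , a<k)))
... | inj₂ refl = here refl
∈-signedValues {suc k} { -[1+ a ]} (_ , s≤s a≤k) with ℕ.m≤n⇒m<n∨m≡n a≤k
... | inj₁ a<k  = there (there (∈-signedValues (s≤s z≤n , a<k)))
... | inj₂ refl = there (here refl)

isSignedPerm? : ∀ n → Decidable (IsSignedPerm n)
isSignedPerm? n v =
  Fin.all? (λ i → (1 ℕ.≤? ∣ lookup v i ∣) ×-dec (∣ lookup v i ∣ ℕ.≤? n)) ×-dec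
  Fin.all? (λ i → Fin.all? (λ j → (∣ lookup v i ∣ ℕ.≟ ∣ lookup v j ∣) →-dec (i Fin.≟ j)))

signedPerms : (n : ℕ) → List (Point n)
signedPerms n = filter (isSignedPerm? n) (vectorsOver (signedValues n) n)

∈-signedPerms⁺ : ∀ {n v} → IsSignedPerm n v → v ∈ signedPerms n
∈-signedPerms⁺ {n} v-sp@(bounds , _) =
  ∈-filter⁺ (isSignedPerm? n) (∈-vectorsOver (∈-signedValues ∘ bounds)) v-sp

∈-signedPerms⁻ : ∀ {n v} → v ∈ signedPerms n → IsSignedPerm n v
∈-signedPerms⁻ {n} = proj₂ ∘ ∈-filter⁻ (isSignedPerm? n) {xs = vectorsOver (signedValues n) n}

isSignedPerm-reindex : ∀ {n} {u w : Point n} (π : Fin n → Fin n) → Injective _≡_ _≡_ π →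
                       (∀ k → ∣ lookup u k ∣ ≡ ∣ lookup w (π k) ∣) →
                       IsSignedPerm n w → IsSignedPerm n u
isSignedPerm-reindex {n} π π-injective ∣u∣≡∣w∘π∣ (bounds , distinct) =
  (λ k → subst (λ a → 1 ℕ.≤ a × a ℕ.≤ n) (sym (∣u∣≡∣w∘π∣ k)) (bounds (π k))) ,
  (λ k l ∣uₖ∣≡∣uₗ∣ → π-injective (distinct (π k) (π l)
     (trans (sym (∣u∣≡∣w∘π∣ k)) (trans ∣uₖ∣≡∣uₗ∣ (∣u∣≡∣w∘π∣ l)))))

isSignedPerm-[]≔ : ∀ {n} {w : Point n} {i x} → ∣ x ∣ ≡ ∣ lookup w i ∣ →
                   IsSignedPerm n w → IsSignedPerm n (w [ i ]≔ x)
isSignedPerm-[]≔ {w = w} {i} {x} ∣x∣≡∣wᵢ∣ = isSignedPerm-reindex {u = w [ i ]≔ x} {w} id id ∣u∣≡∣w∣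
  where
  ∣u∣≡∣w∣ : ∀ k → ∣ lookup (w [ i ]≔ x) k ∣ ≡ ∣ lookup w k ∣
  ∣u∣≡∣w∣ k with i Fin.≟ k
  ... | yes refl = trans (cong ∣_∣ (lookup∘update i w x)) ∣x∣≡∣wᵢ∣
  ... | no  i≢k  = cong ∣_∣ (lookup∘update′ (i≢k ∘ sym) w x)

module _ {n} {i j : Fin n} where

  transpose-left : transpose i j i ≡ j
  transpose-left rewrite dec-true (i Fin.≟ i) refl = refl

  transpose-right : i ≢ j → transpose i j j ≡ i
  transpose-right i≢j rewrite dec-false (j Fin.≟ i) (i≢j ∘ sym) | dec-true (j Fin.≟ j) refl = refl

  transpose-other : ∀ {k} → k ≢ i → k ≢ j → transpose i j k ≡ k
  transpose-other {k} k≢i k≢j rewrite dec-false (k Fin.≟ i) k≢i | dec-false (k Fin.≟ j) k≢j = refl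

  transpose-injective : Injective _≡_ _≡_ (transpose i j)
  transpose-injective eq =
    trans (sym (transpose-inverse j i)) (trans (cong (transpose j i) eq) (transpose-inverse j i))

  isSignedPerm-swap : i ≢ j → ∀ {w : Point n} {x y} → ∣ x ∣ ≡ ∣ lookup w j ∣ → ∣ y ∣ ≡ ∣ lookup w i ∣ →
                      IsSignedPerm n w → IsSignedPerm n ((w [ i ]≔ x) [ j ]≔ y)
  isSignedPerm-swap i≢j {w} {x} {y} ∣x∣≡∣wⱼ∣ ∣y∣≡∣wᵢ∣ =
    isSignedPerm-reindex {u = u} {w} (transpose i j) transpose-injective (λ k → ∣u∣≡∣w∘τ∣ (k Fin.≟ j) (k Fin.≟ i))
    where
    open ≡-Reasoning
    u : Point n
    u = (w [ i ]≔ x) [ j ]≔ y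
    ∣u∣≡∣w∘τ∣ : ∀ {k} → Dec (k ≡ j) → Dec (k ≡ i) → ∣ lookup u k ∣ ≡ ∣ lookup w (transpose i j k) ∣
    ∣u∣≡∣w∘τ∣ (yes refl) _        = begin
      ∣ lookup u j ∣                 ≡⟨ cong ∣_∣ (lookup∘update j (w [ i ]≔ x) y) ⟩
      ∣ y ∣                          ≡⟨ ∣y∣≡∣wᵢ∣ ⟩
      ∣ lookup w i ∣                 ≡⟨ cong (∣_∣ ∘ lookup w) (transpose-right i≢j) ⟨
      ∣ lookup w (transpose i j j) ∣ ∎
    ∣u∣≡∣w∘τ∣ (no k≢j) (yes refl) = begin
      ∣ lookup u i ∣                 ≡⟨ cong ∣_∣ (lookup∘update′ k≢j (w [ i ]≔ x) y) ⟩
      ∣ lookup (w [ i ]≔ x) i ∣      ≡⟨ cong ∣_∣ (lookup∘update i w x) ⟩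
      ∣ x ∣                          ≡⟨ ∣x∣≡∣wⱼ∣ ⟩
      ∣ lookup w j ∣                 ≡⟨ cong (∣_∣ ∘ lookup w) transpose-left ⟨
      ∣ lookup w (transpose i j i) ∣ ∎
    ∣u∣≡∣w∘τ∣ {k} (no k≢j) (no k≢i)   = begin
      ∣ lookup u k ∣                 ≡⟨ cong ∣_∣ (lookup∘update′ k≢j (w [ i ]≔ x) y) ⟩
      ∣ lookup (w [ i ]≔ x) k ∣      ≡⟨ cong ∣_∣ (lookup∘update′ k≢i w x) ⟩
      ∣ lookup w k ∣                 ≡⟨ cong (∣_∣ ∘ lookup w) (transpose-other k≢i k≢j) ⟨
      ∣ lookup w (transpose i j k) ∣ ∎

dot-[]≔ : ∀ {n} (c v : Point n) i x →
          dot c (v [ i ]≔ x) + lookup c i * lookup v i ≡ dot c v + lookup c i * x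
dot-[]≔ (a ∷ c) (b ∷ v) zero    x = ℤ+.xy∙z≈zy∙x (a * x) (dot c v) (a * b)
dot-[]≔ (a ∷ c) (b ∷ v) (suc i) x = begin
  a * b + dot c (v [ i ]≔ x) + lookup c i * lookup v i   ≡⟨ ℤ.+-assoc (a * b) _ _ ⟩
  a * b + (dot c (v [ i ]≔ x) + lookup c i * lookup v i) ≡⟨ cong (λ z → a * b + z) (dot-[]≔ c v i x) ⟩
  a * b + (dot c v + lookup c i * x)                     ≡⟨ ℤ.+-assoc (a * b) _ _ ⟨
  a * b + dot c v + lookup c i * x                       ∎
  where open ≡-Reasoning

dot-[]≔-[]≔ : ∀ {n} (c v : Point n) {i j} → i ≢ j → ∀ x y →
              dot c ((v [ i ]≔ x) [ j ]≔ y) + (lookup c j * lookup v j + lookup c i * lookup v i)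
              ≡ dot c v + (lookup c i * x + lookup c j * y)
dot-[]≔-[]≔ c v {i} {j} i≢j x y = begin
  dot c u + (cⱼ * lookup v j + cᵢ * lookup v i)            ≡⟨ ℤ.+-assoc (dot c u) _ _ ⟨
  dot c u + cⱼ * lookup v j + cᵢ * lookup v i              ≡⟨ cong (λ a → dot c u + cⱼ * a + cᵢ * lookup v i)
                                                                  (lookup∘update′ (i≢j ∘ sym) v x) ⟨
  dot c u + cⱼ * lookup (v [ i ]≔ x) j + cᵢ * lookup v i   ≡⟨ cong (_+ cᵢ * lookup v i)
                                                                  (dot-[]≔ c (v [ i ]≔ x) j y) ⟩
  dot c (v [ i ]≔ x) + cⱼ * y + cᵢ * lookup v i            ≡⟨ ℤ+.xy∙z≈xz∙y (dot c (v [ i ]≔ x)) (cⱼ * y) _ ⟩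
  dot c (v [ i ]≔ x) + cᵢ * lookup v i + cⱼ * y            ≡⟨ cong (_+ cⱼ * y) (dot-[]≔ c v i x) ⟩
  dot c v + cᵢ * x + cⱼ * y                                ≡⟨ ℤ.+-assoc (dot c v) _ _ ⟩
  dot c v + (cᵢ * x + cⱼ * y)                              ∎
  where
  open ≡-Reasoning
  u : Point _
  u = (v [ i ]≔ x) [ j ]≔ y
  cᵢ cⱼ : ℤ
  cᵢ = lookup c i
  cⱼ = lookup c j

dot-zeroˡ : ∀ {n} (c : Point n) → (∀ i → lookup c i ≡ 0ℤ) → ∀ u → dot c u ≡ 0ℤ
dot-zeroˡ []      _   []      = refl
dot-zeroˡ (a ∷ c) c≡0 (b ∷ u) rewrite c≡0 zero =
  trans (ℤ.+-identityˡ (dot c u)) (dot-zeroˡ c (c≡0 ∘ suc) u)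

-i≤i⇒0≤i : ∀ {i} → - i ≤ i → 0ℤ ≤ i
-i≤i⇒0≤i {+ _}      _  = +≤+ z≤n
-i≤i⇒0≤i { -[1+ _ ]} ()

*-sign◃ : ∀ i m → i * (sign i ◃ m) ≡ + (∣ i ∣ ℕ.* m)
*-sign◃ i m = begin
  i * (sign i ◃ m)                         ≡⟨ cong (_* (sign i ◃ m)) (ℤ.◃-inverse i) ⟨
  (sign i ◃ ∣ i ∣) * (sign i ◃ m)          ≡⟨ ℤ.◃-distrib-* (sign i) (sign i) ∣ i ∣ m ⟨
  (sign i Sign.* sign i) ◃ (∣ i ∣ ℕ.* m)   ≡⟨ cong (_◃ (∣ i ∣ ℕ.* m)) (s*s≡+ (sign i)) ⟩
  Sign.+ ◃ (∣ i ∣ ℕ.* m)                   ≡⟨ ℤ.+◃n≡+n (∣ i ∣ ℕ.* m) ⟩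
  + (∣ i ∣ ℕ.* m)                          ∎
  where open ≡-Reasoning

rearrangement : ∀ {A B a b} → B ℕ.< A → a ℕ.< b → B ℕ.* b ℕ.+ A ℕ.* a ℕ.< A ℕ.* b ℕ.+ B ℕ.* a
rearrangement {A} {B} {a} {b} B<A a<b
  with d , refl ← ℕ.m≤n⇒∃[o]m+o≡n B<A | e , refl ← ℕ.m≤n⇒∃[o]m+o≡n a<b =
  subst (B ℕ.* (suc a ℕ.+ e) ℕ.+ (suc B ℕ.+ d) ℕ.* a ℕ.<_) (sym (gain B a d e)) (ℕ.m<m+n _ (s≤s z≤n))
  where
  open +-*-Solver
  gain : ∀ B a d e → (suc B ℕ.+ d) ℕ.* (suc a ℕ.+ e) ℕ.+ B ℕ.* a
                     ≡ (B ℕ.* (suc a ℕ.+ e) ℕ.+ (suc B ℕ.+ d) ℕ.* a) ℕ.+ suc d ℕ.* suc e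
  gain = solve 4 (λ B a d e → (con 1 :+ B :+ d) :* (con 1 :+ a :+ e) :+ B :* a
                              := (B :* (con 1 :+ a :+ e) :+ (con 1 :+ B :+ d) :* a) :+ (con 1 :+ d) :* (con 1 :+ e))
                 refl

module _ {n} {c w : Point n} (w∈F : InFace n c w) where

  private
    w-sp : IsSignedPerm n w
    w-sp = proj₁ w∈F

  maximiser-exchange : ∀ {u p q} → IsSignedPerm n u → dot c u + p ≡ dot c w + q → q ≤ p
  maximiser-exchange u-sp eq = ℤ.≮⇒≥ λ p<q → ℤ.<-irrefl eq (ℤ.+-mono-≤-< (proj₂ w∈F _ u-sp) p<q)

  maximiser-sign : ∀ i → 0ℤ ≤ lookup c i * lookup w i
  maximiser-sign i =
    -i≤i⇒0≤i (subst (_≤ lookup c i * lookup w i) (sym (ℤ.neg-distribʳ-* (lookup c i) (lookup w i))) flip-loses)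
    where
    flip-loses : lookup c i * - lookup w i ≤ lookup c i * lookup w i
    flip-loses = maximiser-exchange (isSignedPerm-[]≔ {w = w} (ℤ.∣-i∣≡∣i∣ (lookup w i)) w-sp) (dot-[]≔ c w i _)

  maximiser-aligned : ∀ i → lookup c i * lookup w i ≡ + (∣ lookup c i ∣ ℕ.* ∣ lookup w i ∣)
  maximiser-aligned i =
    trans (sym (ℤ.0≤i⇒+∣i∣≡i (maximiser-sign i))) (cong +_ (ℤ.abs-* (lookup c i) (lookup w i)))

  -- If ∣wᵢ∣ < ∣wⱼ∣, exchanging them (with the signs of c) would gain (∣cᵢ∣ − ∣cⱼ∣)(∣wⱼ∣ − ∣wᵢ∣) > 0.
  maximiser-monotone : ∀ {i j} → ∣ lookup c j ∣ ℕ.< ∣ lookup c i ∣ → ∣ lookup w j ∣ ℕ.< ∣ lookup w i ∣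
  maximiser-monotone {i} {j} ∣cⱼ∣<∣cᵢ∣ with ∣ lookup w j ∣ ℕ.<? ∣ lookup w i ∣
  ... | yes ∣wⱼ∣<∣wᵢ∣ = ∣wⱼ∣<∣wᵢ∣
  ... | no  ∣wⱼ∣≮∣wᵢ∣ =
    contradiction (maximiser-exchange swapped-sp (dot-[]≔-[]≔ c w i≢j x y)) (ℤ.<⇒≱ swap-gains)
    where
    i≢j : i ≢ j
    i≢j refl = ℕ.<-irrefl refl ∣cⱼ∣<∣cᵢ∣
    ∣wᵢ∣<∣wⱼ∣ : ∣ lookup w i ∣ ℕ.< ∣ lookup w j ∣
    ∣wᵢ∣<∣wⱼ∣ = ℕ.≤∧≢⇒< (ℕ.≮⇒≥ ∣wⱼ∣≮∣wᵢ∣) (i≢j ∘ proj₂ w-sp i j)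
    x y : ℤ
    x = sign (lookup c i) ◃ ∣ lookup w j ∣
    y = sign (lookup c j) ◃ ∣ lookup w i ∣
    swapped-sp : IsSignedPerm n ((w [ i ]≔ x) [ j ]≔ y)
    swapped-sp = isSignedPerm-swap i≢j {w} (ℤ.abs-◃ _ _) (ℤ.abs-◃ _ _) w-sp
    swap-gains : lookup c j * lookup w j + lookup c i * lookup w i < lookup c i * x + lookup c j * y
    swap-gains = subst₂ _<_
      (trans (ℤ.pos-+ (∣ lookup c j ∣ ℕ.* ∣ lookup w j ∣) _)
             (sym (cong₂ _+_ (maximiser-aligned j) (maximiser-aligned i))))
      (trans (ℤ.pos-+ (∣ lookup c i ∣ ℕ.* ∣ lookup w j ∣) _)
             (sym (cong₂ _+_ (*-sign◃ (lookup c i) _) (*-sign◃ (lookup c j) _))))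
      (+<+ (rearrangement ∣cⱼ∣<∣cᵢ∣ ∣wᵢ∣<∣wⱼ∣))

maxAbs : ∀ {n} → Point n → ℕ
maxAbs []      = 0
maxAbs (x ∷ c) = ∣ x ∣ ⊔ maxAbs c

∣lookup∣≤maxAbs : ∀ {n} (c : Point n) i → ∣ lookup c i ∣ ℕ.≤ maxAbs c
∣lookup∣≤maxAbs (x ∷ c) zero    = ℕ.m≤m⊔n ∣ x ∣ (maxAbs c)
∣lookup∣≤maxAbs (x ∷ c) (suc i) = ℕ.≤-trans (∣lookup∣≤maxAbs c i) (ℕ.m≤n⊔m ∣ x ∣ (maxAbs c))

maxAbs-attained : ∀ {n} (c : Point n) → maxAbs c ≡ 0 ⊎ ∃[ i ] ∣ lookup c i ∣ ≡ maxAbs c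
maxAbs-attained []      = inj₁ refl
maxAbs-attained (x ∷ c) with ℕ.⊔-sel ∣ x ∣ (maxAbs c) | maxAbs-attained c
... | inj₁ ⊔≡∣x∣ | _                = inj₂ (zero , sym ⊔≡∣x∣)
... | inj₂ ⊔≡M   | inj₁ M≡0         = inj₁ (trans ⊔≡M M≡0)
... | inj₂ ⊔≡M   | inj₂ (i , ∣cᵢ∣≡M) = inj₂ (suc i , trans ∣cᵢ∣≡M (sym ⊔≡M))

signum : ℤ → ℤ
signum +0       = 0ℤ
signum +[1+ _ ] = 1ℤ
signum -[1+ _ ] = -1ℤ

signum-*-pos : ∀ {x w} → 0ℤ ≤ x * w → x ≢ 0ℤ → 1 ℕ.≤ ∣ w ∣ → 0ℤ < signum x * w
signum-*-pos {+0}                    _  x≢0 _ = contradiction refl x≢0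
signum-*-pos {+[1+ _ ]} {+[1+ _ ]}   _  _   _ = +<+ (s≤s z≤n)
signum-*-pos { -[1+ _ ]} { -[1+ _ ]} _  _   _ = +<+ (s≤s z≤n)
signum-*-pos {+[1+ _ ]} { -[1+ _ ]}  () _   _
signum-*-pos { -[1+ _ ]} {+[1+ _ ]}  () _   _
signum-*-pos {+[1+ _ ]} {+0}         _  _   ()
signum-*-pos { -[1+ _ ]} {+0}        _  _   ()

signs : List ℤ
signs = 0ℤ ∷ 1ℤ ∷ -1ℤ ∷ []

signVectors : (n : ℕ) → List (Point n)
signVectors = vectorsOver signs

topEntry : ℕ → ℤ → ℤ
topEntry M x with ∣ x ∣ ℕ.≟ M
... | yes _ = signum x
... | no  _ = 0ℤ

top : ∀ {n} → Point n → Point n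
top c = Vec.map (topEntry (maxAbs c)) c

lookup-top : ∀ {n} (c : Point n) i → lookup (top c) i ≡ topEntry (maxAbs c) (lookup c i)
lookup-top c i = lookup-map i (topEntry (maxAbs c)) c

topEntry∈signs : ∀ M x → topEntry M x ∈ signs
topEntry∈signs M x with ∣ x ∣ ℕ.≟ M
topEntry∈signs M +0       | yes _ = here refl
topEntry∈signs M +[1+ _ ] | yes _ = there (here refl)
topEntry∈signs M -[1+ _ ] | yes _ = there (there (here refl))
... | no _ = here refl

topEntry≢0 : ∀ M x → topEntry M x ≢ 0ℤ → ∣ x ∣ ≡ M × topEntry M x ≡ signum x
topEntry≢0 M x t≢0 with ∣ x ∣ ℕ.≟ M
... | yes ∣x∣≡M = ∣x∣≡M , refl
... | no  _     = contradiction refl t≢0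

topEntry≡0 : ∀ M x → topEntry M x ≡ 0ℤ → ∣ x ∣ ≡ M → x ≡ 0ℤ
topEntry≡0 M x t≡0 ∣x∣≡M with ∣ x ∣ ℕ.≟ M
topEntry≡0 M +0 _ _ | yes _ = refl
... | no ∣x∣≢M = contradiction ∣x∣≡M ∣x∣≢M

top∈signVectors : ∀ {n} (c : Point n) → top c ∈ signVectors n
top∈signVectors c =
  ∈-vectorsOver λ i → subst (_∈ signs) (sym (lookup-top c i)) (topEntry∈signs (maxAbs c) (lookup c i))

facet-top≢0 : ∀ {n} {c : Point n} → IsFacet n c → top c ≢ replicate n 0ℤ
facet-top≢0 {n} {c} ((w , w-sp , w∉F) , _) top≡0 =
  w∉F (w-sp , λ u _ → ℤ.≤-reflexive (trans (dot-zeroˡ c c≡0 u) (sym (dot-zeroˡ c c≡0 w))))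
  where
  topᵢ≡0 : ∀ i → topEntry (maxAbs c) (lookup c i) ≡ 0ℤ
  topᵢ≡0 i = trans (sym (lookup-top c i)) (trans (cong (λ t → lookup t i) top≡0) (lookup-replicate i 0ℤ))
  M≡0 : maxAbs c ≡ 0
  M≡0 with maxAbs-attained c
  ... | inj₁ M≡0          = M≡0
  ... | inj₂ (i , ∣cᵢ∣≡M) = trans (sym ∣cᵢ∣≡M) (cong ∣_∣ (topEntry≡0 (maxAbs c) (lookup c i) (topᵢ≡0 i) ∣cᵢ∣≡M))
  c≡0 : ∀ i → lookup c i ≡ 0ℤ
  c≡0 i = ℤ.∣i∣≡0⇒i≡0 (ℕ.n≤0⇒n≡0 (subst (∣ lookup c i ∣ ℕ.≤_) M≡0 (∣lookup∣≤maxAbs c i)))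

Compatible : ∀ {n} → Point n → Point n → Set
Compatible t w = ∀ i → lookup t i ≢ 0ℤ →
  0ℤ < lookup t i * lookup w i × (∀ j → lookup t j ≡ 0ℤ → ∣ lookup w j ∣ ℕ.< ∣ lookup w i ∣)

compatible? : ∀ {n} (t w : Point n) → Dec (Compatible t w)
compatible? t w = Fin.all? λ i → ¬? (lookup t i ℤ.≟ 0ℤ) →-dec
  ((0ℤ ℤ.<? lookup t i * lookup w i) ×-dec
   Fin.all? λ j → (lookup t j ℤ.≟ 0ℤ) →-dec (∣ lookup w j ∣ ℕ.<? ∣ lookup w i ∣))

maximiser-compatible : ∀ {n} {c w : Point n} → InFace n c w → Compatible (top c) w
maximiser-compatible {c = c} {w} w∈F i tᵢ≢0 =
  subst (λ t → 0ℤ < t * lookup w i) (sym tᵢ≡signum)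
    (signum-*-pos (maximiser-sign {c = c} {w} w∈F i) cᵢ≢0 (proj₁ (proj₁ (proj₁ w∈F) i))) ,
  λ j tⱼ≡0 → maximiser-monotone {c = c} {w} w∈F (∣cⱼ∣<∣cᵢ∣ j (trans (sym (lookup-top c j)) tⱼ≡0))
  where
  M : ℕ
  M = maxAbs c
  topᵢ≢0 : topEntry M (lookup c i) ≢ 0ℤ
  topᵢ≢0 = tᵢ≢0 ∘ trans (lookup-top c i)
  ∣cᵢ∣≡M : ∣ lookup c i ∣ ≡ M
  ∣cᵢ∣≡M = proj₁ (topEntry≢0 M (lookup c i) topᵢ≢0)
  tᵢ≡signum : lookup (top c) i ≡ signum (lookup c i)
  tᵢ≡signum = trans (lookup-top c i) (proj₂ (topEntry≢0 M (lookup c i) topᵢ≢0))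
  cᵢ≢0 : lookup c i ≢ 0ℤ
  cᵢ≢0 cᵢ≡0 = tᵢ≢0 (trans tᵢ≡signum (cong signum cᵢ≡0))
  ∣cⱼ∣<∣cᵢ∣ : ∀ j → topEntry M (lookup c j) ≡ 0ℤ → ∣ lookup c j ∣ ℕ.< ∣ lookup c i ∣
  ∣cⱼ∣<∣cᵢ∣ j topⱼ≡0 with ℕ.m≤n⇒m<n∨m≡n (∣lookup∣≤maxAbs c j)
  ... | inj₁ ∣cⱼ∣<M = subst (∣ lookup c j ∣ ℕ.<_) (sym ∣cᵢ∣≡M) ∣cⱼ∣<M
  ... | inj₂ ∣cⱼ∣≡M = subst (ℕ._< ∣ lookup c i ∣) (sym (cong ∣_∣ (topEntry≡0 M (lookup c j) topⱼ≡0 ∣cⱼ∣≡M)))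
                        (ℕ.n≢0⇒n>0 (cᵢ≢0 ∘ ℤ.∣i∣≡0⇒i≡0))

-- Certificates quantify over a list V of the vertices, passed as a parameter so that the
-- enumeration is evaluated only once when they are checked.
module Enumerated {n : ℕ} (V : List (Point n))
                  (∈V⁺ : ∀ {v} → IsSignedPerm n v → v ∈ V) (∈V⁻ : ∀ {v} → v ∈ V → IsSignedPerm n v) where

  inFace⇔ : ∀ {c M y} → All (λ u → dot c u ≤ M) V → IsSignedPerm n y → dot c y ≡ M →
            ∀ w → InFace n c w ⇔ (IsSignedPerm n w × dot c w ≡ M)
  inFace⇔ {c} {M} bounded y-sp cy≡M w = mk⇔
    (λ (w-sp , w-max) → w-sp , ℤ.≤-antisym (All.lookup bounded (∈V⁺ w-sp)) (subst (_≤ dot c w) cy≡M (w-max _ y-sp)))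
    (λ (w-sp , cw≡M) → w-sp , λ u u-sp → subst (dot c u ≤_) (sym cw≡M) (All.lookup bounded (∈V⁺ u-sp)))

  IsEdgeNormal : Point n → Point n → Point n → Set
  IsEdgeNormal c u v = IsSignedPerm n u × IsSignedPerm n v × u ≢ v × dot c v ≡ dot c u ×
                       All (λ w → dot c w ≤ dot c u) V × All (λ w → dot c w ≡ dot c u → w ≡ u ⊎ w ≡ v) V

  isEdgeNormal? : ∀ c u v → Dec (IsEdgeNormal c u v)
  isEdgeNormal? c u v =
    isSignedPerm? n u ×-dec isSignedPerm? n v ×-dec ¬? (u ≟ᵥ v) ×-dec (dot c v ℤ.≟ dot c u) ×-dec
    allᵇ? (λ w → dot c w ℤ.≤? dot c u) V ×-dec
    allᵇ? (λ w → (dot c w ℤ.≟ dot c u) →-dec ((w ≟ᵥ u) ⊎-dec (w ≟ᵥ v))) V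

  isEdgeNormal⇒adjacent : ∀ {c u v} → IsEdgeNormal c u v → Adjacent n u v
  isEdgeNormal⇒adjacent {c} {u} {v} (u-sp , v-sp , u≢v , cv≡cu , bounded , only-u-v) =
    u≢v , c , λ w → mk⇔ (to w) (from w)
    where
    face : ∀ w → InFace n c w ⇔ (IsSignedPerm n w × dot c w ≡ dot c u)
    face = inFace⇔ {c} bounded u-sp refl
    to : ∀ w → InFace n c w → w ≡ u ⊎ w ≡ v
    to w w∈F with w-sp , cw≡cu ← Equivalence.to (face w) w∈F = All.lookup only-u-v (∈V⁺ w-sp) cw≡cu
    from : ∀ w → w ≡ u ⊎ w ≡ v → InFace n c w
    from w (inj₁ refl) = Equivalence.from (face w) (u-sp , refl)
    from w (inj₂ refl) = Equivalence.from (face w) (v-sp , cv≡cu)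

  FaceCertificate : Point n → ℤ → Set
  FaceCertificate t M = All (λ u → dot t u ≤ M) V × Any (λ u → dot t u ≡ M) V ×
                        Any (λ u → dot t u ≢ M) V × All (λ w → dot t w ≡ M ⊎ ¬ Compatible t w) V

  faceCertificate? : ∀ t M → Dec (FaceCertificate t M)
  faceCertificate? t M =
    allᵇ? (λ u → dot t u ℤ.≤? M) V ×-dec anyᵇ? (λ u → dot t u ℤ.≟ M) V ×-dec
    anyᵇ? (λ u → ¬? (dot t u ℤ.≟ M)) V ×-dec allᵇ? (λ w → (dot t w ℤ.≟ M) ⊎-dec ¬? (compatible? t w)) V

  -- The face of c lies in the face of top c, which is proper; c being a facet normal, they coincide.
  facet-face : ∀ {c M} → IsFacet n c → FaceCertificate (top c) M →
               ∀ w → InFace n c w ⇔ (IsSignedPerm n w × dot (top c) w ≡ M)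
  facet-face {c} {M} (_ , maximal) (bounded , attained , proper , attains-or-incompatible) w =
    mk⇔ (Equivalence.to (t-face w) ∘ c⊆t w) (t⊆c w ∘ Equivalence.from (t-face w))
    where
    t : Point n
    t = top c
    t-face : ∀ w → InFace n t w ⇔ (IsSignedPerm n w × dot t w ≡ M)
    t-face with y , y∈V , ty≡M ← find attained = inFace⇔ {t} bounded (∈V⁻ y∈V) ty≡M
    c⊆t : ∀ w → InFace n c w → InFace n t w
    c⊆t w w∈F@(w-sp , _) with All.lookup attains-or-incompatible (∈V⁺ w-sp)
    ... | inj₁ tw≡M         = Equivalence.from (t-face w) (w-sp , tw≡M)
    ... | inj₂ incompatible = contradiction (maximiser-compatible {c = c} w∈F) incompatible
    t⊆c : ∀ w → InFace n t w → InFace n c w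
    t⊆c with maximal t c⊆t
    ... | inj₂ t⊆c  = t⊆c
    ... | inj₁ all⊆t with u , u∈V , tu≢M ← find proper =
      ⊥-elim (tu≢M (proj₂ (Equivalence.to (t-face u) (all⊆t u (∈V⁻ u∈V)))))

  module _ {m : ℕ} (C : Fin (3 ℕ.+ m) → Point n) where

    next previous : Fin (3 ℕ.+ m) → Fin (3 ℕ.+ m)
    next     i = suc (toℕ i) mod (3 ℕ.+ m)
    previous i = (toℕ i ℕ.+ (2 ℕ.+ m)) mod (3 ℕ.+ m)

    -- When u v is an edge, the functional u + v is maximised on the vertices exactly at u and v.
    edgeNormal : Fin (3 ℕ.+ m) → Point n
    edgeNormal i = zipWith _+_ (C i) (C (next i))

    InArc : Fin (3 ℕ.+ m) → ℕ → Fin (3 ℕ.+ m) → Set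
    InArc s k i = ∃[ j ] j ℕ.< k × i ≡ (toℕ s ℕ.+ j) mod (3 ℕ.+ m)

    ArcCertificate : Point n → ℤ → Fin (3 ℕ.+ m) → ℕ → Set
    ArcCertificate t M s k = 1 ℕ.≤ k × k ℕ.≤ 3 ℕ.+ m × (∀ i → dot t (C i) ≡ M ⇔ InArc s k i)

    arcCertificate? : ∀ t M s k → Dec (ArcCertificate t M s k)
    arcCertificate? t M s k = (1 ℕ.≤? k) ×-dec (k ℕ.≤? 3 ℕ.+ m) ×-dec
      Fin.all? λ i → (dot t (C i) ℤ.≟ M) ⇔? ℕ.anyUpTo? (λ j → i Fin.≟ (toℕ s ℕ.+ j) mod (3 ℕ.+ m)) k

    -- The maximum of t and the start and length of the arc on which the cycle attains it are
    -- found by search; the certificate checks them.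
    maxValue : Point n → ℤ
    maxValue t = List.foldr (λ u M → dot t u ℤ.⊔ M) (dot t (C zero)) V

    arcStart : Point n → ℤ → Fin (3 ℕ.+ m)
    arcStart t M = fromMaybe zero (List.find starts (List.allFin (3 ℕ.+ m)))
      where
      starts : Decidable (λ i → dot t (C i) ≡ M × dot t (C (previous i)) ≢ M)
      starts i = (dot t (C i) ℤ.≟ M) ×-dec ¬? (dot t (C (previous i)) ℤ.≟ M)

    arcLength : Point n → ℤ → ℕ
    arcLength t M = Vec.count (λ i → dot t (C i) ℤ.≟ M) (Vec.allFin (3 ℕ.+ m))

    FacetCertificate : Point n → ℤ → Set
    FacetCertificate t M = FaceCertificate t M × ArcCertificate t M (arcStart t M) (arcLength t M)

    facetCertificate? : ∀ t M → Dec (FacetCertificate t M)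
    facetCertificate? t M = faceCertificate? t M ×-dec arcCertificate? t M (arcStart t M) (arcLength t M)

    CycleCertificate : Set
    CycleCertificate =
      (∀ i j → C i ≡ C j → i ≡ j) ×
      (∀ i → IsEdgeNormal (edgeNormal i) (C i) (C (next i))) ×
      All (λ t → t ≢ replicate n 0ℤ → FacetCertificate t (maxValue t)) (signVectors n)

    cycleCertificate? : Dec CycleCertificate
    cycleCertificate? =
      Fin.all? (λ i → Fin.all? λ j → (C i ≟ᵥ C j) →-dec (i Fin.≟ j)) ×-dec
      Fin.all? (λ i → isEdgeNormal? (edgeNormal i) (C i) (C (next i))) ×-dec
      allᵇ? (λ t → ¬? (t ≟ᵥ replicate n 0ℤ) →-dec facetCertificate? t (maxValue t)) (signVectors n)

    certificate⇒isCycle : CycleCertificate → IsCycle n m C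
    certificate⇒isCycle (distinct , edges , _) =
      distinct , λ i → isEdgeNormal⇒adjacent {edgeNormal i} (edges i)

    certificate⇒facetHamiltonian : CycleCertificate → FacetHamiltonian n m C
    certificate⇒facetHamiltonian (_ , edges , facets) c c-facet =
      arc (All.lookup facets (top∈signVectors c) (facet-top≢0 c-facet))
      where
      t : Point n
      t = top c
      arc : ∀ {M} → FacetCertificate t M →
            ∃[ s ] ∃[ k ] 1 ℕ.≤ k × k ℕ.≤ 3 ℕ.+ m × (∀ i → InFace n c (C i) ⇔ InArc s k i)
      arc {M} (face , 1≤k , k≤len , onArc) = arcStart t M , arcLength t M , 1≤k , k≤len , λ i → mk⇔
        (Equivalence.to (onArc i) ∘ proj₂ ∘ Equivalence.to (facet-face {c} c-facet face (C i)))
        (Equivalence.from (facet-face {c} c-facet face (C i)) ∘ (proj₁ (edges i) ,_) ∘ Equivalence.from (onArc i))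

hasFacetHamiltonianCycle : ∀ {n m} (C : Vec (Point n) (3 ℕ.+ m)) →
  {True (Enumerated.cycleCertificate? (signedPerms n) ∈-signedPerms⁺ ∈-signedPerms⁻ (lookup C))} →
  HasFacetHamiltonianCycle n
hasFacetHamiltonianCycle {n} {m} C {certified} =
  m , lookup C , certificate⇒isCycle (lookup C) certificate , certificate⇒facetHamiltonian (lookup C) certificate
  where
  open Enumerated (signedPerms n) ∈-signedPerms⁺ ∈-signedPerms⁻
  certificate : CycleCertificate (lookup C)
  certificate = toWitness certified

module Cycles where
  open import Agda.Builtin.FromNat using (Number; fromNat)
  open import Agda.Builtin.FromNeg using (Negative; fromNeg)
  open import Data.Unit.Base using (⊤; tt)
  import Data.Nat.Literals as ℕ-literals
  import Data.Integer.Literals as ℤ-literals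

  instance
    ℕ-number : Number ℕ
    ℕ-number = ℕ-literals.number
    ℤ-number : Number ℤ
    ℤ-number = ℤ-literals.number
    ℤ-negative : Negative ℤ
    ℤ-negative = ℤ-literals.negative
    unit : ⊤
    unit = tt

  cycle₃ : Vec (Point 3) 26
  cycle₃ =
    (1 ∷ 2 ∷ 3 ∷ []) ∷ (2 ∷ 1 ∷ 3 ∷ []) ∷ (3 ∷ 1 ∷ 2 ∷ []) ∷ (3 ∷ -1 ∷ 2 ∷ [])
    ∷ (3 ∷ -2 ∷ 1 ∷ []) ∷ (2 ∷ -3 ∷ 1 ∷ []) ∷ (1 ∷ -3 ∷ 2 ∷ []) ∷ (-1 ∷ -3 ∷ 2 ∷ [])
    ∷ (-2 ∷ -3 ∷ 1 ∷ []) ∷ (-3 ∷ -2 ∷ 1 ∷ []) ∷ (-3 ∷ -1 ∷ 2 ∷ []) ∷ (-3 ∷ 1 ∷ 2 ∷ [])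
    ∷ (-3 ∷ 2 ∷ 1 ∷ []) ∷ (-3 ∷ 2 ∷ -1 ∷ []) ∷ (-3 ∷ 1 ∷ -2 ∷ []) ∷ (-2 ∷ 1 ∷ -3 ∷ [])
    ∷ (-2 ∷ -1 ∷ -3 ∷ []) ∷ (-1 ∷ -2 ∷ -3 ∷ []) ∷ (1 ∷ -2 ∷ -3 ∷ []) ∷ (2 ∷ -1 ∷ -3 ∷ [])
    ∷ (2 ∷ 1 ∷ -3 ∷ []) ∷ (1 ∷ 2 ∷ -3 ∷ []) ∷ (1 ∷ 3 ∷ -2 ∷ []) ∷ (2 ∷ 3 ∷ -1 ∷ [])
    ∷ (2 ∷ 3 ∷ 1 ∷ []) ∷ (1 ∷ 3 ∷ 2 ∷ []) ∷ []

  cycle₄ : Vec (Point 4) 80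
  cycle₄ =
    (1 ∷ 2 ∷ 3 ∷ 4 ∷ []) ∷ (2 ∷ 1 ∷ 3 ∷ 4 ∷ []) ∷ (2 ∷ 1 ∷ 4 ∷ 3 ∷ []) ∷ (2 ∷ -1 ∷ 4 ∷ 3 ∷ [])
    ∷ (1 ∷ -2 ∷ 4 ∷ 3 ∷ []) ∷ (-1 ∷ -2 ∷ 4 ∷ 3 ∷ []) ∷ (-1 ∷ -3 ∷ 4 ∷ 2 ∷ []) ∷ (-2 ∷ -3 ∷ 4 ∷ 1 ∷ [])
    ∷ (-2 ∷ -4 ∷ 3 ∷ 1 ∷ []) ∷ (-3 ∷ -4 ∷ 2 ∷ 1 ∷ []) ∷ (-3 ∷ -4 ∷ 2 ∷ -1 ∷ []) ∷ (-3 ∷ -4 ∷ 1 ∷ -2 ∷ [])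
    ∷ (-2 ∷ -4 ∷ 1 ∷ -3 ∷ []) ∷ (-1 ∷ -4 ∷ 2 ∷ -3 ∷ []) ∷ (-1 ∷ -3 ∷ 2 ∷ -4 ∷ []) ∷ (1 ∷ -3 ∷ 2 ∷ -4 ∷ [])
    ∷ (1 ∷ -2 ∷ 3 ∷ -4 ∷ []) ∷ (2 ∷ -1 ∷ 3 ∷ -4 ∷ []) ∷ (3 ∷ -1 ∷ 2 ∷ -4 ∷ []) ∷ (4 ∷ -1 ∷ 2 ∷ -3 ∷ [])
    ∷ (4 ∷ -1 ∷ 3 ∷ -2 ∷ []) ∷ (4 ∷ -2 ∷ 3 ∷ -1 ∷ []) ∷ (4 ∷ -3 ∷ 2 ∷ -1 ∷ []) ∷ (4 ∷ -3 ∷ 1 ∷ -2 ∷ [])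
    ∷ (4 ∷ -3 ∷ -1 ∷ -2 ∷ []) ∷ (4 ∷ -3 ∷ -2 ∷ -1 ∷ []) ∷ (4 ∷ -2 ∷ -3 ∷ -1 ∷ []) ∷ (4 ∷ -1 ∷ -3 ∷ -2 ∷ [])
    ∷ (3 ∷ -1 ∷ -4 ∷ -2 ∷ []) ∷ (2 ∷ -1 ∷ -4 ∷ -3 ∷ []) ∷ (1 ∷ -2 ∷ -4 ∷ -3 ∷ []) ∷ (-1 ∷ -2 ∷ -4 ∷ -3 ∷ [])
    ∷ (-1 ∷ -3 ∷ -4 ∷ -2 ∷ []) ∷ (-2 ∷ -3 ∷ -4 ∷ -1 ∷ []) ∷ (-3 ∷ -2 ∷ -4 ∷ -1 ∷ []) ∷ (-3 ∷ -1 ∷ -4 ∷ -2 ∷ [])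
    ∷ (-3 ∷ 1 ∷ -4 ∷ -2 ∷ []) ∷ (-3 ∷ 2 ∷ -4 ∷ -1 ∷ []) ∷ (-2 ∷ 3 ∷ -4 ∷ -1 ∷ []) ∷ (-1 ∷ 3 ∷ -4 ∷ -2 ∷ [])
    ∷ (-1 ∷ 4 ∷ -3 ∷ -2 ∷ []) ∷ (1 ∷ 4 ∷ -3 ∷ -2 ∷ []) ∷ (2 ∷ 4 ∷ -3 ∷ -1 ∷ []) ∷ (3 ∷ 4 ∷ -2 ∷ -1 ∷ [])
    ∷ (3 ∷ 4 ∷ -1 ∷ -2 ∷ []) ∷ (3 ∷ 4 ∷ 1 ∷ -2 ∷ []) ∷ (3 ∷ 4 ∷ 2 ∷ -1 ∷ []) ∷ (2 ∷ 4 ∷ 3 ∷ -1 ∷ [])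
    ∷ (1 ∷ 4 ∷ 3 ∷ -2 ∷ []) ∷ (1 ∷ 4 ∷ 2 ∷ -3 ∷ []) ∷ (-1 ∷ 4 ∷ 2 ∷ -3 ∷ []) ∷ (-2 ∷ 4 ∷ 1 ∷ -3 ∷ [])
    ∷ (-3 ∷ 4 ∷ 1 ∷ -2 ∷ []) ∷ (-4 ∷ 3 ∷ 1 ∷ -2 ∷ []) ∷ (-4 ∷ 2 ∷ 1 ∷ -3 ∷ []) ∷ (-4 ∷ 1 ∷ 2 ∷ -3 ∷ [])
    ∷ (-4 ∷ 1 ∷ 3 ∷ -2 ∷ []) ∷ (-4 ∷ 2 ∷ 3 ∷ -1 ∷ []) ∷ (-4 ∷ 2 ∷ 3 ∷ 1 ∷ []) ∷ (-4 ∷ 1 ∷ 3 ∷ 2 ∷ [])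
    ∷ (-4 ∷ 1 ∷ 2 ∷ 3 ∷ []) ∷ (-3 ∷ 1 ∷ 2 ∷ 4 ∷ []) ∷ (-3 ∷ 2 ∷ 1 ∷ 4 ∷ []) ∷ (-3 ∷ 2 ∷ -1 ∷ 4 ∷ [])
    ∷ (-3 ∷ 1 ∷ -2 ∷ 4 ∷ []) ∷ (-3 ∷ -1 ∷ -2 ∷ 4 ∷ []) ∷ (-3 ∷ -2 ∷ -1 ∷ 4 ∷ []) ∷ (-2 ∷ -3 ∷ -1 ∷ 4 ∷ [])
    ∷ (-1 ∷ -3 ∷ -2 ∷ 4 ∷ []) ∷ (1 ∷ -3 ∷ -2 ∷ 4 ∷ []) ∷ (2 ∷ -3 ∷ -1 ∷ 4 ∷ []) ∷ (3 ∷ -2 ∷ -1 ∷ 4 ∷ [])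
    ∷ (3 ∷ -1 ∷ -2 ∷ 4 ∷ []) ∷ (2 ∷ -1 ∷ -3 ∷ 4 ∷ []) ∷ (2 ∷ 1 ∷ -3 ∷ 4 ∷ []) ∷ (1 ∷ 2 ∷ -3 ∷ 4 ∷ [])
    ∷ (1 ∷ 3 ∷ -2 ∷ 4 ∷ []) ∷ (2 ∷ 3 ∷ -1 ∷ 4 ∷ []) ∷ (2 ∷ 3 ∷ 1 ∷ 4 ∷ []) ∷ (1 ∷ 3 ∷ 2 ∷ 4 ∷ []) ∷ []

proposition2p2 : HasFacetHamiltonianCycle 3 × HasFacetHamiltonianCycle 4
proposition2p2 = hasFacetHamiltonianCycle cycle₃ , hasFacetHamiltonianCycle cycle₄
  where open Cycles
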